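{- Let $\Gamma$, $\omega$, $\mathcal V$ and the Markov chain $M$ be as in the context. Let $\sigma$ and $\lambda$ be probability distributions on $\mathcal V$ and assume that $M$ converges to $\lambda$ when starting in $\sigma$, i.e. $\sum_{\mathbf g'\in\mathcal V}\sigma(\mathbf g')p^{(k)}(\mathbf g',\mathbf g)\to\lambda(\mathbf g)$ as $k\to\infty$ for every $\mathbf g\in\mathcal V$. Then for every $f\in\Gamma$, with $n=ar(f)$, and every $\bar x^1,\bar x^2\in D^n$, $$\sum_{\mathbf g\in\mathcal V}\sigma(\mathbf g)f^2(\mathbf g(\bar x^1,\bar x^2))\ \ge\ \sum_{\mathbf g\in\mathcal V}\lambda(\mathbf g)f^2(\mathbf g(\bar x^1,\bar x^2)).$$
   Context: Setting: $D$ finite; $\Gamma$ a valued language on $D$ (a set of functions $f:D^m\to\mathbb{Q}_{\ge0}$) that is a core (every operation in the support of every unary fractional polymorphism of $\Gamma$ is injective); $\Gamma_c$ is obtained from $\Gamma$ by adding all functions obtained by fixing some variables of functions of $\Gamma$ to domain values; $\Gamma_c$ does not satisfy (MC), i.e. there are no distinct $a,b\in D$ and binary $h\in\langle\Gamma_c\rangle$ with $\arg\min h=\{(a,b),(b,a)\}$, where $\langle\Delta\rangle$ is the set of functions $f(x_1,\dots,x_m)=\min_{x_{m+1},\dots,x_n}\sum_iw_if_i(\bar x^i)$ with $f_i\in\Delta$, $w_i\in\mathbb{Q}_{\ge0}$. $\omega$ is a binary fractional polymorphism of $\Gamma_c$ (a map $\omega$ from binary operations on $D$ to $\mathbb{Q}_{\ge0}$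 with $\sum\omega=1$ and $\sum_g\omega(g)f(g(\bar x,\bar y))\le\frac12(f(\bar x)+f(\bar y))$ for all $f\in\Gamma_c$ and $\bar x,\bar y\in D^{ar(f)}$, componentwise) such that for all distinct $a,b\in D$ there is $g\in\mathrm{supp}(\omega)=\{g:\omega(g)>0\}$ with $\{g(a,b),g(b,a)\}\ne\{a,b\}$. Construction: $\bar g(x,y)=g(y,x)$; for $\mathbf g=(g,\bar g):D^2\to D^2$ and binary $h$, $\mathbf g^h=(h\circ(g,\bar g),h\circ(\bar g,g))$; $\mathbf 1$ is the identity on $D^2$; $\mathcal V=\{\mathbf 1^{h_1\dots h_k}:k\ge0,h_i\in\mathrm{supp}(\omega)\}$. The Markov chain $M$ on state set $\mathcal V$ has transition probabilities $p(\mathbf g,\mathbf g')=\frac12w(\mathbf g,\mathbf g')+\frac12$ if $\mathbf g=\mathbf g'$ and $\frac12w(\mathbf g,\mathbf g')$ otherwise, where $w(\mathbf g,\mathbf g')=\sum_{h\in\mathrm{supp}(\omega):\mathbf g'=\mathbf g^h}\omega(h)$; $p^{(k)}$ denotes the $k$-step transition probability. For $f$ of arity $n$ and $\bar u,\bar v\in D^n$, $f^2(\bar u,\bar v)=\frac12(f(\bar u)+f(\bar v))$, and $\mathbf g(\bar x^1,\bar x^2)$ is computed componentwise.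
   Formalization: The probability distributions σ and λ on $\mathcal V$ take rational values. -}

module Defs where

open import Data.Nat as ℕ using (ℕ; zero; suc)
open import Data.Fin using (Fin)
open import Data.Fin.Properties renaming (_≟_ to _≟F_)
open import Data.Vec as Vec using (Vec; []; _∷_; lookup; tabulate; zipWith)
open import Data.Vec.Properties using (≡-dec)
open import Data.List as List using (List; []; _∷_; map; allFin; foldl)
open import Data.List.Membership.Propositional using (_∈_)
open import Data.List.Relation.Unary.All using (All)
open import Data.Maybe using (Maybe; just; nothing)
open import Data.Product using (Σ; ∃; _×_; _,_; proj₁; proj₂)
open import Data.Sum using (_⊎_)
open import Data.Bool using (if_then_else_)
open import Relation.Nullary using (¬_; Dec; yes; no)
open import Relation.Nullary.Decidable using (⌊_⌋)
open import Relation.Binary.PropositionalEquality using (_≡_; _≢_; subst; sym)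
open import Function.Definitions using (Injective)
open import Data.Rational as ℚ using (ℚ; 0ℚ; 1ℚ; ½; _+_; _*_; _-_; _≤_; _<_; ∣_∣)

sumℚ : List ℚ → ℚ
sumℚ = List.foldr _+_ 0ℚ

allVecs : {A : Set} → (n : ℕ) → List A → List (Vec A n)
allVecs zero    xs = [] ∷ []
allVecs (suc n) xs = List.concatMap (λ x → map (x ∷_) (allVecs n xs)) xs

-- Domain D = Fin d; tuples D^n are Vec (Fin d) n.

-- A valued language on D: a set of (arity, function D^n → ℚ) pairs.
Lang : ℕ → Set₁
Lang d = (n : ℕ) → (Vec (Fin d) n → ℚ) → Set

NonNegLang : {d : ℕ} → Lang d → Set
NonNegLang {d} Γ = ∀ n f → Γ n f → ∀ (x : Vec (Fin d) n) → 0ℚ ≤ f x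

-- Γ_c : fixing some variables to domain values.
-- A pattern c : Vec (Maybe D) n fixes position i to a if c[i] = just a
-- and leaves it free if c[i] = nothing; free positions are filled in order.

numFree : {A : Set} {n : ℕ} → Vec (Maybe A) n → ℕ
numFree []            = 0
numFree (just _ ∷ c)  = numFree c
numFree (nothing ∷ c) = suc (numFree c)

fill : {A : Set} {n : ℕ} → (c : Vec (Maybe A) n) → Vec A (numFree c) → Vec A n
fill []            xs       = []
fill (just a ∷ c)  xs       = a ∷ fill c xs
fill (nothing ∷ c) (x ∷ xs) = x ∷ fill c xs

Constants : {d : ℕ} → Lang d → Lang d
Constants {d} Γ m f' =
  Σ ℕ λ n → Σ (Vec (Fin d) n → ℚ) λ f → Σ (Vec (Maybe (Fin d)) n) λ c →
    Γ n f × Σ (numFree c ≡ m) λ e →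
      ∀ (x : Vec (Fin d) m) → f' x ≡ f (fill c (subst (Vec (Fin d)) (sym e) x))

-- Expressive power ⟨Δ⟩, binary case.
-- A constraint on N variables: a function f ∈ Δ of arity a, a scope
-- (tuple of variables), and a weight w ∈ ℚ≥0.

Constraint : {d : ℕ} → Lang d → ℕ → Set
Constraint {d} Δ N =
  Σ ℕ λ a → Σ (Vec (Fin d) a → ℚ) λ f → Δ a f × Vec (Fin N) a × Σ ℚ λ w → 0ℚ ≤ w

evalConstraints : {d N : ℕ} {Δ : Lang d} → List (Constraint Δ N) → Vec (Fin d) N → ℚ
evalConstraints cs σ =
  sumℚ (map (λ { (a , f , _ , sc , w , _) → w * f (Vec.map (lookup σ) sc) }) cs)

-- h(x1,x2) = min_{x3..x_{k+2}} Σ_i w_i f_i(x̄^i)  (min written out relationally)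
Expressible2 : {d : ℕ} → Lang d → (Fin d → Fin d → ℚ) → Set
Expressible2 {d} Δ h =
  Σ ℕ λ k → Σ (List (Constraint Δ (2 ℕ.+ k))) λ cs →
    ∀ x y → (Σ (Vec (Fin d) k) λ z → evalConstraints cs (x ∷ y ∷ z) ≡ h x y)
          × (∀ (z : Vec (Fin d) k) → h x y ≤ evalConstraints cs (x ∷ y ∷ z))

-- (MC): distinct a b and binary h ∈ ⟨Δ⟩ with argmin h = {(a,b),(b,a)}
MC : {d : ℕ} → Lang d → Set
MC {d} Δ =
  Σ (Fin d) λ a → Σ (Fin d) λ b → a ≢ b × Σ (Fin d → Fin d → ℚ) λ h →
    Expressible2 Δ h ×
    (∀ x y → ((∀ x' y' → h x y ≤ h x' y') → (x ≡ a × y ≡ b) ⊎ (x ≡ b × y ≡ a))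
           × ((x ≡ a × y ≡ b) ⊎ (x ≡ b × y ≡ a) → ∀ x' y' → h x y ≤ h x' y'))

-- Unary fractional polymorphisms and cores.
-- A finitely supported distribution is a list of (operation, weight) with
-- positive weights summing to 1 (support = the listed operations).

IsUnaryFP : {d : ℕ} → Lang d → List ((Fin d → Fin d) × ℚ) → Set
IsUnaryFP {d} Γ ν =
  All (λ p → 0ℚ < proj₂ p) ν × sumℚ (map proj₂ ν) ≡ 1ℚ ×
  (∀ n f → Γ n f → ∀ (x : Vec (Fin d) n) →
     sumℚ (map (λ { (u , w) → w * f (Vec.map u x) }) ν) ≤ f x)

IsCore : {d : ℕ} → Lang d → Set
IsCore {d} Γ = ∀ ν → IsUnaryFP Γ ν → ∀ u w → (u , w) ∈ ν → Injective _≡_ _≡_ u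

-- Binary operations on D, represented as tables (canonical, decidable ≡).

Op : ℕ → Set
Op d = Vec (Vec (Fin d) d) d

app : {d : ℕ} → Op d → Fin d → Fin d → Fin d
app t x y = lookup (lookup t x) y

_≟Op_ : {d : ℕ} → (g h : Op d) → Dec (g ≡ h)
_≟Op_ = ≡-dec (≡-dec _≟F_)

allOps : (d : ℕ) → List (Op d)
allOps d = allVecs d (allVecs d (allFin d))

ΣOp : {d : ℕ} → (Op d → ℚ) → ℚ
ΣOp {d} F = sumℚ (map F (allOps d))

supp : {d : ℕ} → List (Op d × ℚ) → List (Op d)
supp = map proj₁

IsBinaryFP : {d : ℕ} → Lang d → List (Op d × ℚ) → Set
IsBinaryFP {d} Γ ω =
  All (λ p → 0ℚ < proj₂ p) ω × sumℚ (map proj₂ ω) ≡ 1ℚ ×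
  (∀ n f → Γ n f → ∀ (x y : Vec (Fin d) n) →
     sumℚ (map (λ { (g , w) → w * f (zipWith (app g) x y) }) ω) ≤ ½ * (f x + f y))

SeparatesPairs : {d : ℕ} → List (Op d × ℚ) → Set
SeparatesPairs {d} ω =
  ∀ (a b : Fin d) → a ≢ b → Σ (Op d) λ g → g ∈ supp ω ×
    ¬ ((app g a b ≡ a × app g b a ≡ b) ⊎ (app g a b ≡ b × app g b a ≡ a))

-- The Markov chain.  A pair 𝐠 = (g, ḡ) with ḡ(x,y) = g(y,x) is determined
-- by g, so states are represented by their first component g.

one : {d : ℕ} → Op d
one = tabulate λ x → tabulate λ y → x

-- 𝐠^h : first component h ∘ (g , ḡ), i.e. (x,y) ↦ h(g(x,y), g(y,x))
_^_ : {d : ℕ} → Op d → Op d → Op d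
g ^ h = tabulate λ x → tabulate λ y → app h (app g x y) (app g y x)

InV : {d : ℕ} → List (Op d × ℚ) → Op d → Set
InV ω g = Σ (List _) λ hs → All (λ h → h ∈ supp ω) hs × g ≡ foldl _^_ one hs

δ : {d : ℕ} → Op d → Op d → ℚ
δ g g' = if ⌊ g ≟Op g' ⌋ then 1ℚ else 0ℚ

wt : {d : ℕ} → List (Op d × ℚ) → Op d → Op d → ℚ
wt ω g g' = sumℚ (map (λ { (h , c) → if ⌊ g' ≟Op (g ^ h) ⌋ then c else 0ℚ }) ω)

trans : {d : ℕ} → List (Op d × ℚ) → Op d → Op d → ℚ
trans ω g g' = ½ * wt ω g g' + ½ * δ g g'

transK : {d : ℕ} → List (Op d × ℚ) → ℕ → Op d → Op d → ℚ
transK ω zero    g g' = δ g g'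
transK ω (suc k) g g' = ΣOp λ c → transK ω k g c * trans ω c g'

-- probability distribution on 𝒱 (extended by 0 to all operations)
IsDistOnV : {d : ℕ} → List (Op d × ℚ) → (Op d → ℚ) → Set
IsDistOnV ω σ = (∀ g → 0ℚ ≤ σ g) × (∀ g → σ g ≢ 0ℚ → InV ω g) × ΣOp σ ≡ 1ℚ

ConvergesTo : {d : ℕ} → List (Op d × ℚ) → (Op d → ℚ) → (Op d → ℚ) → Set
ConvergesTo ω σ λ' =
  ∀ g → InV ω g → ∀ ε → 0ℚ < ε → Σ ℕ λ N → ∀ k → N ℕ.≤ k →
    ∣ ΣOp (λ g' → σ g' * transK ω k g' g) - λ' g ∣ < ε

f2 : {d n : ℕ} → (Vec (Fin d) n → ℚ) → Op d → Vec (Fin d) n → Vec (Fin d) n → ℚ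
f2 f g x₁ x₂ = ½ * (f (zipWith (app g) x₁ x₂) + f (zipWith (app g) x₂ x₁))

-- Put F 𝐠 = f²(𝐠(x̄¹,x̄²)).  Applying the binary fractional polymorphism ω to
-- the pair g(x̄¹,x̄²), ḡ(x̄¹,x̄²) shows Σₕ ω(h) F(𝐠^h) ≤ F 𝐠, so F is
-- superharmonic for one step of M, hence for k steps: the expectation of F
-- under the distribution of M at time k never exceeds its expectation under σ.
-- These expectations are finite sums, and F ≥ 0 because Γ is nonnegative, so
-- the bound passes to the limit λ.
module Submission where

open import Defs
open import Algebra using (CommutativeMonoid)
open import Data.Bool using (if_then_else_)
open import Data.Empty using (⊥-elim)
open import Data.Fin using (Fin; zero; suc)
open import Data.Fin.Properties using (suc-injective)
open import Data.List using (List; []; _∷_; map; _++_; concatMap; allFin)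
open import Data.List.Properties using (map-tabulate)
open import Data.List.Relation.Unary.All as All using (All; []; _∷_)
open import Data.Maybe using (Maybe; nothing)
open import Data.Nat as ℕ using (ℕ; zero; suc)
import Data.Nat.Properties as ℕ
open import Data.Product using (∃-syntax; _×_; _,_; proj₁; proj₂)
open import Data.Rational as ℚ
  using (ℚ; 0ℚ; 1ℚ; ½; _+_; _*_; -_; _-_; 1/_; _≤_; _<_; ∣_∣; nonNegative; positive)
open import Data.Rational.Properties
open import Data.Rational.Solver using (module +-*-Solver)
open import Data.Sum using (inj₁; inj₂)
open import Data.Vec as Vec using (Vec; []; _∷_; lookup; tabulate; zipWith)
open import Data.Vec.Properties using (∷-injectiveˡ; ∷-injectiveʳ; lookup∘tabulate)
open import Function using (id; _∘_)
open import Relation.Binary.PropositionalEquality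
  using (_≡_; _≢_; refl; sym; cong; cong₂; subst; module ≡-Reasoning)
  renaming (trans to ≡-trans)
open import Relation.Nullary using (¬_; Dec; yes; no)
open import Relation.Nullary.Decidable using (⌊_⌋)

open import Algebra.Properties.CommutativeSemigroup
  (CommutativeMonoid.commutativeSemigroup +-0-commutativeMonoid) using (interchange)
open +-*-Solver using (solve; _:+_; _:*_; :-_; _:=_; con)

private
  variable
    A B : Set

∑ : List A → (A → ℚ) → ℚ
∑ xs F = sumℚ (map F xs)

syntax ∑ xs (λ x → e) = ∑[ x ∈ xs ] e

sum-cong : (xs : List A) {F G : A → ℚ} → (∀ x → F x ≡ G x) → ∑ xs F ≡ ∑ xs G
sum-cong []       F≡G = refl
sum-cong (x ∷ xs) F≡G = cong₂ _+_ (F≡G x) (sum-cong xs F≡G)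

sum-0 : (xs : List A) {F : A → ℚ} → (∀ x → F x ≡ 0ℚ) → ∑ xs F ≡ 0ℚ
sum-0 []       F≡0 = refl
sum-0 (x ∷ xs) F≡0 = cong₂ _+_ (F≡0 x) (sum-0 xs F≡0)

sum-+ : (xs : List A) (F G : A → ℚ) → ∑[ x ∈ xs ] (F x + G x) ≡ ∑ xs F + ∑ xs G
sum-+ []       F G = refl
sum-+ (x ∷ xs) F G =
  ≡-trans (cong (F x + G x +_) (sum-+ xs F G)) (interchange (F x) (G x) (∑ xs F) (∑ xs G))

sum-*ˡ : (xs : List A) (c : ℚ) (F : A → ℚ) → ∑[ x ∈ xs ] (c * F x) ≡ c * ∑ xs F
sum-*ˡ []       c F = sym (*-zeroʳ c)
sum-*ˡ (x ∷ xs) c F =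
  ≡-trans (cong (c * F x +_) (sum-*ˡ xs c F)) (sym (*-distribˡ-+ c (F x) (∑ xs F)))

sum-*ʳ : (xs : List A) (c : ℚ) (F : A → ℚ) → ∑[ x ∈ xs ] (F x * c) ≡ ∑ xs F * c
sum-*ʳ xs c F =
  ≡-trans (sum-cong xs (λ x → *-comm (F x) c)) (≡-trans (sum-*ˡ xs c F) (*-comm c (∑ xs F)))

sum-comm : (xs : List A) (ys : List B) (F : A → B → ℚ) →
  ∑[ x ∈ xs ] ∑[ y ∈ ys ] F x y ≡ ∑[ y ∈ ys ] ∑[ x ∈ xs ] F x y
sum-comm []       ys F = sym (sum-0 ys (λ _ → refl))
sum-comm (x ∷ xs) ys F =
  ≡-trans (cong (∑ ys (F x) +_) (sum-comm xs ys F)) (sym (sum-+ ys (F x) (λ y → ∑[ x ∈ xs ] F x y)))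

sum-mono-≤ : {xs : List A} {F G : A → ℚ} → All (λ x → F x ≤ G x) xs → ∑ xs F ≤ ∑ xs G
sum-mono-≤ []           = ≤-refl
sum-mono-≤ (F≤G ∷ F≤Gs) = +-mono-≤ F≤G (sum-mono-≤ F≤Gs)

sum-nonNeg : {xs : List A} {F : A → ℚ} → All (λ x → 0ℚ ≤ F x) xs → 0ℚ ≤ ∑ xs F
sum-nonNeg {xs = xs} {F} F≥0 = subst (_≤ ∑ xs F) (sum-0 xs {λ _ → 0ℚ} (λ _ → refl)) (sum-mono-≤ {F = λ _ → 0ℚ} {G = F} F≥0)

sum-++ : (xs ys : List A) (F : A → ℚ) → ∑ (xs ++ ys) F ≡ ∑ xs F + ∑ ys F
sum-++ []       ys F = sym (+-identityˡ _)
sum-++ (x ∷ xs) ys F = ≡-trans (cong (F x +_) (sum-++ xs ys F)) (sym (+-assoc (F x) _ _))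

sum-concatMap : (xs : List A) (G : A → List B) (F : B → ℚ) →
  ∑ (concatMap G xs) F ≡ ∑[ x ∈ xs ] ∑ (G x) F
sum-concatMap []       G F = refl
sum-concatMap (x ∷ xs) G F =
  ≡-trans (sum-++ (G x) (concatMap G xs) F) (cong (∑ (G x) F +_) (sum-concatMap xs G F))

sum-map : (xs : List A) (h : A → B) (F : B → ℚ) → ∑ (map h xs) F ≡ ∑[ x ∈ xs ] F (h x)
sum-map []       h F = refl
sum-map (x ∷ xs) h F = cong (F (h x) +_) (sum-map xs h F)

-- Equivalently: every element of A occurs in xs exactly once.
Enumerates : List A → Set
Enumerates {A} xs = ∀ (t : A) (T : A → ℚ) → (∀ v → v ≢ t → T v ≡ 0ℚ) → ∑ xs T ≡ T t

sum-allFin-suc : (n : ℕ) (T : Fin (suc n) → ℚ) → ∑ (allFin (suc n)) T ≡ T zero + ∑ (allFin n) (T ∘ suc)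
sum-allFin-suc n T =
  cong (T zero +_) (≡-trans (cong (λ xs → ∑ xs T) (sym (map-tabulate id suc))) (sum-map (allFin n) suc T))

enumerates-allFin : (n : ℕ) → Enumerates (allFin n)
enumerates-allFin (suc n) zero T T-point = begin
  ∑ (allFin (suc n)) T             ≡⟨ sum-allFin-suc n T ⟩
  T zero + ∑ (allFin n) (T ∘ suc)  ≡⟨ cong (T zero +_) (sum-0 (allFin n) (λ v → T-point (suc v) λ ())) ⟩
  T zero + 0ℚ                      ≡⟨ +-identityʳ (T zero) ⟩
  T zero                           ∎
  where open ≡-Reasoning
enumerates-allFin (suc n) (suc t) T T-point = begin
  ∑ (allFin (suc n)) T             ≡⟨ sum-allFin-suc n T ⟩
  T zero + ∑ (allFin n) (T ∘ suc)  ≡⟨ cong₂ _+_ (T-point zero λ ()) (enumerates-allFin n t (T ∘ suc) T∘suc-point) ⟩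
  0ℚ + T (suc t)                   ≡⟨ +-identityˡ (T (suc t)) ⟩
  T (suc t)                        ∎
  where
  open ≡-Reasoning
  T∘suc-point : ∀ v → v ≢ t → T (suc v) ≡ 0ℚ
  T∘suc-point v v≢t = T-point (suc v) (v≢t ∘ suc-injective)

enumerates-allVecs : (xs : List A) → Enumerates xs → (n : ℕ) → Enumerates (allVecs n xs)
enumerates-allVecs xs enum zero    []       T T-point = +-identityʳ (T [])
enumerates-allVecs xs enum (suc n) (a ∷ t) T T-point = begin
  ∑ (allVecs (suc n) xs) T                    ≡⟨ sum-concatMap xs (λ x → map (x ∷_) (allVecs n xs)) T ⟩
  ∑[ x ∈ xs ] ∑ (map (x ∷_) (allVecs n xs)) T ≡⟨ enum a _ off-head ⟩
  ∑ (map (a ∷_) (allVecs n xs)) T             ≡⟨ sum-map (allVecs n xs) (a ∷_) T ⟩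
  ∑[ v ∈ allVecs n xs ] T (a ∷ v)             ≡⟨ enumerates-allVecs xs enum n t (T ∘ (a ∷_)) off-tail ⟩
  T (a ∷ t)                                   ∎
  where
  open ≡-Reasoning
  off-head : ∀ x → x ≢ a → ∑ (map (x ∷_) (allVecs n xs)) T ≡ 0ℚ
  off-head x x≢a = ≡-trans (sum-map (allVecs n xs) (x ∷_) T)
    (sum-0 (allVecs n xs) (λ v → T-point (x ∷ v) (x≢a ∘ ∷-injectiveˡ)))
  off-tail : ∀ v → v ≢ t → T (a ∷ v) ≡ 0ℚ
  off-tail v v≢t = T-point (a ∷ v) (v≢t ∘ ∷-injectiveʳ)

enumerates-allOps : (d : ℕ) → Enumerates (allOps d)
enumerates-allOps d = enumerates-allVecs _ (enumerates-allVecs (allFin d) (enumerates-allFin d) d) d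

sum-indicator : (xs : List A) → Enumerates xs → (t : A) (ι F : A → ℚ) →
  (∀ v → v ≢ t → ι v ≡ 0ℚ) → ∑[ v ∈ xs ] (ι v * F v) ≡ ι t * F t
sum-indicator xs enum t ι F ι-point =
  enum t (λ v → ι v * F v) (λ v v≢t → ≡-trans (cong (_* F v) (ι-point v v≢t)) (*-zeroˡ (F v)))

+-nonNeg : {p q : ℚ} → 0ℚ ≤ p → 0ℚ ≤ q → 0ℚ ≤ p + q
+-nonNeg = +-mono-≤

*-nonNeg : {p q : ℚ} → 0ℚ ≤ p → 0ℚ ≤ q → 0ℚ ≤ p * q
*-nonNeg {p} {q} p≥0 q≥0 =
  nonNegative⁻¹ (p * q) {{nonNeg*nonNeg⇒nonNeg p {{nonNegative p≥0}} q {{nonNegative q≥0}}}}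

∣-∣<⇒<+ : (m l η : ℚ) → ∣ m - l ∣ < η → l < m + η
∣-∣<⇒<+ m l η ∣m-l∣<η with ∣p∣≡p∨∣p∣≡-p (m - l)
... | inj₁ ∣m-l∣≡m-l = begin-strict
  l                ≡⟨ solve 2 (λ m l → l := m :+ (:- (m :+ (:- l)))) refl m l ⟩
  m - (m - l)      ≤⟨ +-monoʳ-≤ m (neg-antimono-≤ (∣p∣≡p⇒0≤p ∣m-l∣≡m-l)) ⟩
  m - 0ℚ           ≡⟨ +-identityʳ m ⟩
  m                <⟨ subst (_< m + η) (+-identityʳ m) (+-monoʳ-< m η>0) ⟩
  m + η            ∎
  where
  open ≤-Reasoning
  η>0 : 0ℚ < η
  η>0 = ≤-<-trans (∣p∣≡p⇒0≤p ∣m-l∣≡m-l) (subst (_< η) ∣m-l∣≡m-l ∣m-l∣<η)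
... | inj₂ ∣m-l∣≡l-m = begin-strict
  l                ≡⟨ solve 2 (λ m l → l := m :+ (:- (m :+ (:- l)))) refl m l ⟩
  m - (m - l)      <⟨ +-monoʳ-< m (subst (_< η) ∣m-l∣≡l-m ∣m-l∣<η) ⟩
  m + η            ∎
  where open ≤-Reasoning

-- Witness for the contradiction: η = (L - B) / (1 + C).
≤-by-slack : {L B C : ℚ} → 0ℚ ≤ C → (∀ η → 0ℚ < η → L ≤ B + η * C) → L ≤ B
≤-by-slack {L} {B} {C} C≥0 slack with L ≤? B
... | yes L≤B = L≤B
... | no  L≰B = ⊥-elim (<-irrefl refl (begin-strict
  L            ≤⟨ slack η (positive⁻¹ η) ⟩
  B + η * C    <⟨ +-monoʳ-< B ηC<ε ⟩
  B + ε        ≡⟨ solve 2 (λ L B → B :+ (L :+ (:- B)) := L) refl L B ⟩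
  L            ∎))
  where
  open ≤-Reasoning
  ε D : ℚ
  ε = L - B
  D = 1ℚ + C
  instance
    ε-pos : ℚ.Positive ε
    ε-pos = positive (subst (_< ε) (+-inverseʳ B) (+-monoˡ-< (- B) (≰⇒> L≰B)))
    D-pos : ℚ.Positive D
    D-pos = positive (<-≤-trans (positive⁻¹ 1ℚ) (subst (_≤ D) (+-identityʳ 1ℚ) (+-monoʳ-≤ 1ℚ C≥0)))
    D-nonZero : ℚ.NonZero D
    D-nonZero = pos⇒nonZero D
    1/D-pos : ℚ.Positive (1/ D)
    1/D-pos = 1/pos⇒pos D
  η : ℚ
  η = ε * 1/ D
  instance
    η-pos : ℚ.Positive η
    η-pos = pos*pos⇒pos ε (1/ D)
  ηC<ε : η * C < ε
  ηC<ε = <-≤-trans (*-monoʳ-<-pos η (subst (_< D) (+-identityˡ C) (+-monoˡ-< C (positive⁻¹ 1ℚ))))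
    (≤-reflexive (≡-trans (*-assoc ε (1/ D) D) (≡-trans (cong (ε *_) (*-inverseˡ D)) (*-identityʳ ε))))

record Eventually (P : ℕ → Set) : Set where
  constructor eventually
  field
    threshold      : ℕ
    from-threshold : ∀ k → threshold ℕ.≤ k → P k

eventually-mono : {P Q : ℕ → Set} → (∀ {k} → P k → Q k) → Eventually P → Eventually Q
eventually-mono P⇒Q (eventually N P-from-N) = eventually N λ k N≤k → P⇒Q (P-from-N k N≤k)

eventually-× : {P Q : ℕ → Set} → Eventually P → Eventually Q → Eventually (λ k → P k × Q k)
eventually-× (eventually M P-from-M) (eventually N Q-from-N) =
  eventually (M ℕ.⊔ N) λ k M⊔N≤k → P-from-M k (ℕ.≤-trans (ℕ.m≤m⊔n M N) M⊔N≤k) ,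
                                   Q-from-N k (ℕ.≤-trans (ℕ.m≤n⊔m M N) M⊔N≤k)

eventually-All : (xs : List A) {P : A → ℕ → Set} → (∀ x → Eventually (P x)) →
  Eventually (λ k → All (λ x → P x k) xs)
eventually-All []       ev = eventually 0 λ _ _ → []
eventually-All (x ∷ xs) ev =
  eventually-mono (λ (p , ps) → p ∷ ps) (eventually-× (ev x) (eventually-All xs ev))

_⟶_ : (ℕ → ℚ) → ℚ → Set
a ⟶ l = ∀ ε → 0ℚ < ε → ∃[ N ] ∀ k → N ℕ.≤ k → ∣ a k - l ∣ < ε

⟶-eventually-< : {a : ℕ → ℚ} {l η : ℚ} → a ⟶ l → 0ℚ < η → Eventually (λ k → l < a k + η)
⟶-eventually-< {a} {l} {η} a⟶l η>0 with a⟶l η η>0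
... | N , close-from-N = eventually N λ k N≤k → ∣-∣<⇒<+ (a k) l η (close-from-N k N≤k)

-- Convergence is only needed where λ is nonzero: elsewhere λ F = 0 ≤ μₖ F.
sum-limit-≤ : (xs : List A) (F λ' : A → ℚ) (μ : ℕ → A → ℚ) {B : ℚ} →
  (∀ x → 0ℚ ≤ F x) → (∀ k x → 0ℚ ≤ μ k x) → (∀ x → λ' x ≢ 0ℚ → (λ k → μ k x) ⟶ λ' x) →
  (∀ k → ∑[ x ∈ xs ] (μ k x * F x) ≤ B) → ∑[ x ∈ xs ] (λ' x * F x) ≤ B
sum-limit-≤ xs F λ' μ {B} F≥0 μ≥0 μ⟶λ μF≤B = ≤-by-slack (sum-nonNeg (All.universal F≥0 xs)) bound
  where
  termwise : ∀ η → 0ℚ < η → ∀ x → Eventually (λ k → λ' x * F x ≤ (μ k x + η) * F x)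
  termwise η η>0 x with λ' x ≟ 0ℚ
  ... | yes λx≡0 = eventually 0 λ k _ → subst (_≤ _) (sym (≡-trans (cong (_* F x) λx≡0) (*-zeroˡ (F x))))
                                    (*-nonNeg (+-nonNeg (μ≥0 k x) (<⇒≤ η>0)) (F≥0 x))
  ... | no  λx≢0 = eventually-mono (λ λ<μ+η → *-monoʳ-≤-nonNeg (F x) {{nonNegative (F≥0 x)}} (<⇒≤ λ<μ+η))
                                   (⟶-eventually-< {λ k → μ k x} (μ⟶λ x λx≢0) η>0)
  bound : ∀ η → 0ℚ < η → ∑[ x ∈ xs ] (λ' x * F x) ≤ B + η * ∑ xs F
  bound η η>0 with eventually-All xs (termwise η η>0)
  ... | eventually N termwise-from-N = begin
    ∑[ x ∈ xs ] (λ' x * F x)                     ≤⟨ sum-mono-≤ (termwise-from-N N ℕ.≤-refl) ⟩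
    ∑[ x ∈ xs ] ((μ N x + η) * F x)              ≡⟨ sum-cong xs (λ x → *-distribʳ-+ (F x) (μ N x) η) ⟩
    ∑[ x ∈ xs ] (μ N x * F x + η * F x)          ≡⟨ ≡-trans (sum-+ xs (λ x → μ N x * F x) (λ x → η * F x)) (cong (∑[ x ∈ xs ] (μ N x * F x) +_) (sum-*ˡ xs η F)) ⟩
    ∑[ x ∈ xs ] (μ N x * F x) + η * ∑ xs F       ≤⟨ +-monoˡ-≤ (η * ∑ xs F) (μF≤B N) ⟩
    B + η * ∑ xs F                               ∎
    where open ≤-Reasoning

sum-mixture-≤ : (xs : List A) (ys : List B) (a : A → ℚ) (K : A → B → ℚ) (F : B → ℚ) (G : A → ℚ) →
  (∀ x → 0ℚ ≤ a x) → (∀ x → ∑[ y ∈ ys ] (K x y * F y) ≤ G x) →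
  ∑[ y ∈ ys ] ((∑[ x ∈ xs ] (a x * K x y)) * F y) ≤ ∑[ x ∈ xs ] (a x * G x)
sum-mixture-≤ xs ys a K F G a≥0 KF≤G = begin
  ∑[ y ∈ ys ] ((∑[ x ∈ xs ] (a x * K x y)) * F y) ≡⟨ sum-cong ys (λ y → sym (sum-*ʳ xs (F y) (λ x → a x * K x y))) ⟩
  ∑[ y ∈ ys ] ∑[ x ∈ xs ] (a x * K x y * F y)     ≡⟨ sum-comm ys xs (λ y x → a x * K x y * F y) ⟩
  ∑[ x ∈ xs ] ∑[ y ∈ ys ] (a x * K x y * F y)     ≡⟨ sum-cong xs pull-out ⟩
  ∑[ x ∈ xs ] (a x * ∑[ y ∈ ys ] (K x y * F y))   ≤⟨ sum-mono-≤ (All.universal weigh xs) ⟩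
  ∑[ x ∈ xs ] (a x * G x)                         ∎
  where
  open ≤-Reasoning
  pull-out : ∀ x → ∑[ y ∈ ys ] (a x * K x y * F y) ≡ a x * ∑[ y ∈ ys ] (K x y * F y)
  pull-out x = ≡-trans (sum-cong ys (λ y → *-assoc (a x) (K x y) (F y))) (sum-*ˡ ys (a x) _)
  weigh : ∀ x → a x * ∑[ y ∈ ys ] (K x y * F y) ≤ a x * G x
  weigh x = *-monoˡ-≤-nonNeg (a x) {{nonNegative (a≥0 x)}} (KF≤G x)

if-dec-true : {P : Set} (P? : Dec P) {c c' : ℚ} → P → (if ⌊ P? ⌋ then c else c') ≡ c
if-dec-true (yes _) p  = refl
if-dec-true (no ¬p) p = ⊥-elim (¬p p)

if-dec-false : {P : Set} (P? : Dec P) {c c' : ℚ} → ¬ P → (if ⌊ P? ⌋ then c else c') ≡ c'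
if-dec-false (yes p) ¬p = ⊥-elim (¬p p)
if-dec-false (no _)  ¬p = refl

if-nonNeg : {P : Set} (P? : Dec P) {c : ℚ} → 0ℚ ≤ c → 0ℚ ≤ (if ⌊ P? ⌋ then c else 0ℚ)
if-nonNeg (yes _) c≥0 = c≥0
if-nonNeg (no _)  _   = ≤-refl

module _ {d : ℕ} (ω : List (Op d × ℚ)) where

  δ-nonNeg : (g g' : Op d) → 0ℚ ≤ δ g g'
  δ-nonNeg g g' = if-nonNeg (g ≟Op g') (<⇒≤ (positive⁻¹ 1ℚ))

  wt-nonNeg : All (λ p → 0ℚ < proj₂ p) ω → (g g' : Op d) → 0ℚ ≤ wt ω g g'
  wt-nonNeg ω>0 g g' = sum-nonNeg (All.map (λ {p} w>0 → if-nonNeg (g' ≟Op (g ^ proj₁ p)) (<⇒≤ w>0)) ω>0)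

  trans-nonNeg : All (λ p → 0ℚ < proj₂ p) ω → (g g' : Op d) → 0ℚ ≤ trans ω g g'
  trans-nonNeg ω>0 g g' = +-nonNeg (*-nonNeg ½≥0 (wt-nonNeg ω>0 g g')) (*-nonNeg ½≥0 (δ-nonNeg g g'))
    where
    ½≥0 : 0ℚ ≤ ½
    ½≥0 = <⇒≤ (positive⁻¹ ½)

  transK-nonNeg : All (λ p → 0ℚ < proj₂ p) ω → (k : ℕ) (g g' : Op d) → 0ℚ ≤ transK ω k g g'
  transK-nonNeg ω>0 zero    g g' = δ-nonNeg g g'
  transK-nonNeg ω>0 (suc k) g g' =
    sum-nonNeg (All.universal (λ c → *-nonNeg (transK-nonNeg ω>0 k g c) (trans-nonNeg ω>0 c g')) (allOps d))

  sum-δ : (t : Op d) (F : Op d → ℚ) → ΣOp (λ g → δ t g * F g) ≡ F t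
  sum-δ t F = begin
    ΣOp (λ g → δ t g * F g) ≡⟨ sum-indicator (allOps d) (enumerates-allOps d) t (δ t) F (λ v v≢t → if-dec-false (t ≟Op v) (v≢t ∘ sym)) ⟩
    δ t t * F t             ≡⟨ cong (_* F t) (if-dec-true (t ≟Op t) refl) ⟩
    1ℚ * F t                ≡⟨ *-identityˡ (F t) ⟩
    F t                     ∎
    where open ≡-Reasoning

  sum-wt : (c : Op d) (F : Op d → ℚ) → ΣOp (λ g → wt ω c g * F g) ≡ ∑[ p ∈ ω ] (proj₂ p * F (c ^ proj₁ p))
  sum-wt c F = begin
    ΣOp (λ g → wt ω c g * F g)                ≡⟨ sum-cong (allOps d) (λ g → sym (sum-*ʳ ω (F g) (λ p → ι p g))) ⟩
    ΣOp (λ g → ∑[ p ∈ ω ] (ι p g * F g))      ≡⟨ sum-comm (allOps d) ω (λ g p → ι p g * F g) ⟩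
    ∑[ p ∈ ω ] ΣOp (λ g → ι p g * F g)        ≡⟨ sum-cong ω select ⟩
    ∑[ p ∈ ω ] (proj₂ p * F (c ^ proj₁ p))    ∎
    where
    open ≡-Reasoning
    ι : Op d × ℚ → Op d → ℚ
    ι (h , w) g = if ⌊ g ≟Op (c ^ h) ⌋ then w else 0ℚ
    select : ∀ p → ΣOp (λ g → ι p g * F g) ≡ proj₂ p * F (c ^ proj₁ p)
    select (h , w) = ≡-trans
      (sum-indicator (allOps d) (enumerates-allOps d) (c ^ h) (ι (h , w)) F (λ v v≢c^h → if-dec-false (v ≟Op (c ^ h)) v≢c^h))
      (cong (_* F (c ^ h)) (if-dec-true ((c ^ h) ≟Op (c ^ h)) refl))

  -- The lazy half of a step of M keeps F fixed, the other half averages F over 𝐠 ↦ 𝐠^h.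
  trans-superharmonic : (F : Op d → ℚ) → (∀ c → ∑[ p ∈ ω ] (proj₂ p * F (c ^ proj₁ p)) ≤ F c) →
    ∀ c → ΣOp (λ g → trans ω c g * F g) ≤ F c
  trans-superharmonic F F-avg c = begin
    ΣOp (λ g → trans ω c g * F g)
      ≡⟨ sum-cong (allOps d) (λ g → *-distribʳ-+ (F g) (½ * wt ω c g) (½ * δ c g)) ⟩
    ΣOp (λ g → ½ * wt ω c g * F g + ½ * δ c g * F g)
      ≡⟨ sum-+ (allOps d) _ _ ⟩
    ΣOp (λ g → ½ * wt ω c g * F g) + ΣOp (λ g → ½ * δ c g * F g)
      ≡⟨ cong₂ _+_ (pull-½ (wt ω c)) (pull-½ (δ c)) ⟩
    ½ * ΣOp (λ g → wt ω c g * F g) + ½ * ΣOp (λ g → δ c g * F g)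
      ≡⟨ cong₂ (λ u v → ½ * u + ½ * v) (sum-wt c F) (sum-δ c F) ⟩
    ½ * ∑[ p ∈ ω ] (proj₂ p * F (c ^ proj₁ p)) + ½ * F c
      ≤⟨ +-monoˡ-≤ (½ * F c) (*-monoˡ-≤-nonNeg ½ (F-avg c)) ⟩
    ½ * F c + ½ * F c
      ≡⟨ solve 1 (λ a → con ½ :* a :+ con ½ :* a := a) refl (F c) ⟩
    F c ∎
    where
    open ≤-Reasoning
    pull-½ : (K : Op d → ℚ) → ΣOp (λ g → ½ * K g * F g) ≡ ½ * ΣOp (λ g → K g * F g)
    pull-½ K = ≡-trans (sum-cong (allOps d) (λ g → *-assoc ½ (K g) (F g))) (sum-*ˡ (allOps d) ½ _)

  transK-superharmonic : All (λ p → 0ℚ < proj₂ p) ω → (F : Op d → ℚ) →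
    (∀ c → ΣOp (λ g → trans ω c g * F g) ≤ F c) →
    ∀ k c → ΣOp (λ g → transK ω k c g * F g) ≤ F c
  transK-superharmonic ω>0 F F-super zero    c = ≤-reflexive (sum-δ c F)
  transK-superharmonic ω>0 F F-super (suc k) c = ≤-trans
    (sum-mixture-≤ (allOps d) (allOps d) (transK ω k c) (trans ω) F F (transK-nonNeg ω>0 k c) F-super)
    (transK-superharmonic ω>0 F F-super k c)

app-^ : {d : ℕ} (g h : Op d) (a b : Fin d) → app (g ^ h) a b ≡ app h (app g a b) (app g b a)
app-^ g h a b =
  ≡-trans (cong (λ row → lookup row b) (lookup∘tabulate (λ x → tabulate λ y → app h (app g x y) (app g y x)) a))
          (lookup∘tabulate (λ y → app h (app g a y) (app g y a)) b)

zipWith-^ : {d n : ℕ} (g h : Op d) (x y : Vec (Fin d) n) →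
  zipWith (app (g ^ h)) x y ≡ zipWith (app h) (zipWith (app g) x y) (zipWith (app g) y x)
zipWith-^ g h []      []      = refl
zipWith-^ g h (a ∷ x) (b ∷ y) = cong₂ _∷_ (app-^ g h a b) (zipWith-^ g h x y)

f2-average-≤ : {d n : ℕ} (ω : List (Op d × ℚ)) (f : Vec (Fin d) n → ℚ) →
  (∀ x y → ∑[ p ∈ ω ] (proj₂ p * f (zipWith (app (proj₁ p)) x y)) ≤ ½ * (f x + f y)) →
  (x₁ x₂ : Vec (Fin d) n) (c : Op d) → ∑[ p ∈ ω ] (proj₂ p * f2 f (c ^ proj₁ p) x₁ x₂) ≤ f2 f c x₁ x₂
f2-average-≤ ω f ω-fp x₁ x₂ c = begin
  ∑[ p ∈ ω ] (proj₂ p * f2 f (c ^ proj₁ p) x₁ x₂)  ≡⟨ sum-cong ω split ⟩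
  ∑[ p ∈ ω ] (½ * (fXY p + fYX p))                 ≡⟨ ≡-trans (sum-*ˡ ω ½ _) (cong (½ *_) (sum-+ ω fXY fYX)) ⟩
  ½ * (∑ ω fXY + ∑ ω fYX)                          ≤⟨ *-monoˡ-≤-nonNeg ½ (+-mono-≤ (ω-fp X Y) (ω-fp Y X)) ⟩
  ½ * (½ * (f X + f Y) + ½ * (f Y + f X))          ≡⟨ solve 2 (λ a b → con ½ :* (con ½ :* (a :+ b) :+ con ½ :* (b :+ a))
                                                                  := con ½ :* (a :+ b)) refl (f X) (f Y) ⟩
  f2 f c x₁ x₂                                     ∎
  where
  open ≤-Reasoning
  X Y : Vec _ _
  X = zipWith (app c) x₁ x₂
  Y = zipWith (app c) x₂ x₁
  fXY fYX : _ × ℚ → ℚ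
  fXY (h , w) = w * f (zipWith (app h) X Y)
  fYX (h , w) = w * f (zipWith (app h) Y X)
  split : ∀ p → proj₂ p * f2 f (c ^ proj₁ p) x₁ x₂ ≡ ½ * (fXY p + fYX p)
  split (h , w) = ≡-trans
    (cong (λ z → w * (½ * z)) (cong₂ (λ u v → f u + f v) (zipWith-^ c h x₁ x₂) (zipWith-^ c h x₂ x₁)))
    (solve 3 (λ w a b → w :* (con ½ :* (a :+ b)) := con ½ :* (w :* a :+ w :* b)) refl w _ _)

f2-nonNeg : {d n : ℕ} (f : Vec (Fin d) n → ℚ) → (∀ x → 0ℚ ≤ f x) →
  (g : Op d) (x₁ x₂ : Vec (Fin d) n) → 0ℚ ≤ f2 f g x₁ x₂
f2-nonNeg f f≥0 g x₁ x₂ = *-nonNeg (<⇒≤ (positive⁻¹ ½)) (+-nonNeg (f≥0 _) (f≥0 _))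

subst-∷ : {m n : ℕ} (e : m ≡ n) (a : A) (xs : Vec A n) →
  subst (Vec A) (sym (cong suc e)) (a ∷ xs) ≡ a ∷ subst (Vec A) (sym e) xs
subst-∷ refl a xs = refl

numFree-nothing : (n : ℕ) → numFree (Vec.replicate {A = Maybe A} n nothing) ≡ n
numFree-nothing zero    = refl
numFree-nothing (suc n) = cong suc (numFree-nothing n)

fill-nothing : (n : ℕ) (x : Vec A n) → fill (Vec.replicate n nothing) (subst (Vec A) (sym (numFree-nothing n)) x) ≡ x
fill-nothing zero    []      = refl
fill-nothing (suc n) (a ∷ x) =
  ≡-trans (cong (fill (Vec.replicate (suc n) nothing)) (subst-∷ (numFree-nothing n) a x)) (cong (a ∷_) (fill-nothing n x))

Γ⊆Constants : {d : ℕ} (Γ : Lang d) {n : ℕ} {f : Vec (Fin d) n → ℚ} → Γ n f → Constants Γ n f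
Γ⊆Constants Γ {n} {f} f∈Γ =
  n , f , Vec.replicate n nothing , f∈Γ , numFree-nothing n , λ x → cong f (sym (fill-nothing n x))

lemma7p3 : (d : ℕ) (Γ : Lang d) (ω : List (Op d × ℚ)) →
    NonNegLang Γ → IsCore Γ → ¬ MC (Constants Γ) →
    IsBinaryFP (Constants Γ) ω → SeparatesPairs ω →
    (σ λ' : Op d → ℚ) → IsDistOnV ω σ → IsDistOnV ω λ' → ConvergesTo ω σ λ' →
    (n : ℕ) (f : Vec (Fin d) n → ℚ) → Γ n f → (x₁ x₂ : Vec (Fin d) n) →
    ΣOp (λ g → λ' g * f2 f g x₁ x₂) ≤ ΣOp (λ g → σ g * f2 f g x₁ x₂)
lemma7p3 d Γ ω Γ≥0 _ _ (ω>0 , _ , ω-fp) _ σ λ' (σ≥0 , _ , _) (_ , λ'-on-V , _) σ⟶λ' n f f∈Γ x₁ x₂ =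
  sum-limit-≤ (allOps d) F λ' μ F≥0 μ≥0 (λ g λ'g≢0 → σ⟶λ' g (λ'-on-V g λ'g≢0)) μF≤σF
  where
  F : Op d → ℚ
  F g = f2 f g x₁ x₂
  μ : ℕ → Op d → ℚ
  μ k g = ΣOp (λ g' → σ g' * transK ω k g' g)
  F≥0 : ∀ g → 0ℚ ≤ F g
  F≥0 g = f2-nonNeg f (Γ≥0 n f f∈Γ) g x₁ x₂
  μ≥0 : ∀ k g → 0ℚ ≤ μ k g
  μ≥0 k g = sum-nonNeg (All.universal (λ g' → *-nonNeg (σ≥0 g') (transK-nonNeg ω ω>0 k g' g)) (allOps d))
  F-superharmonic : ∀ c → ΣOp (λ g → trans ω c g * F g) ≤ F c
  F-superharmonic = trans-superharmonic ω F (f2-average-≤ ω f (ω-fp n f (Γ⊆Constants Γ f∈Γ)) x₁ x₂)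
  μF≤σF : ∀ k → ΣOp (λ g → μ k g * F g) ≤ ΣOp (λ g → σ g * F g)
  μF≤σF k = sum-mixture-≤ (allOps d) (allOps d) σ (transK ω k) F F σ≥0
    (transK-superharmonic ω ω>0 F F-superharmonic k)
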